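{- Let $\mathcal{A}$ be an architecture over a type system $T$ (definitions in the context). Then: (1) (Weakening) If $\tau_1 \vdash \alpha \ni t : A$ and $\tau_1, \tau_2$ is a valid trace, then $\tau_1, \tau_2 \vdash \alpha \ni t : A$. (2) If $\tau_1, (\alpha \stackrel{t : A}{\rightarrow} \beta), \tau_2$ is a valid trace, then $A \in M_{\alpha\beta}$ and $\tau_1 \vdash \alpha \ni t : A$. (3) (Generation) If $\tau \vdash \beta \ni t : B$, then there exist $m \geq 0$, types $A_1, \ldots, A_m$, a constructor $f : A_1 \rightarrow \cdots \rightarrow A_m \rightarrow B$, terms $t_1 : A_1, \ldots, t_m : A_m$, and agents $\alpha_1, \ldots, \alpha_n$ ($n \geq 1$) such that $t \equiv f t_1 \cdots t_m$, $\beta = \alpha_n$, $f \in H_{\alpha_1}$, the events $\alpha_1 \stackrel{t : B}{\rightarrow} \alpha_2, \ldots, \alpha_{n-1} \stackrel{t : B}{\rightarrow} \alpha_n$ occur in $\tau$ in this order, and $\tau \vdash \alpha_1 \ni t_i : A_i$ for all $i = 1, \ldots, m$. (4) If $\tau \vdash \beta \ni t : B$, then either $\beta$ can compute terms of type $B$, or $\tau$ contains an event $\alpha \stackrel{t : B}{\rightarrow} \beta$ for some agent $\alpha$.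
   Context: A type system consists of a set of atomic types (types are generated from atomic types by: if $A,B$ are types then $A \rightarrow B$ is a type) and a set of constructors, each with an associated type. Terms: every constructor of type $A$ is a term of type $A$; if $s : A \rightarrow B$ and $t : A$ then $st : B$. An architecture over $T$ consists of a set $\mathtt{Ag}$ of agents; for each agent $\alpha$ a set $H_\alpha$ of constructors ($\alpha$ initially possesses them); for each ordered pair of distinct agents $(\alpha,\beta)$ a set $M_{\alpha\beta}$ of atomic types ($\alpha$ may send messages of these types to $\beta$). An agent $\alpha$ can compute terms of type $A$ iff $H_\alpha$ contains a constructor of type $B_1 \rightarrow \cdots \rightarrow B_n \rightarrow A$ for some $n \ge 0$ and types $B_i$. An event is an expression $\alpha \stackrel{t : A}{\rightarrow} \beta$ (with $t:A$); a trace is a finite sequence of events; $\tau_1,\tau_2$ denotes concatenation. Judgements $\tau \vdash \alpha \ni t : A$ are derivable by the rules: (init) if $c : A \in H_\alpha$ then $\vdash \alpha \ni c : A$ (empty trace); (message$_1$) if $\tau \vdash \alpha \ni t : A$ and $A \in M_{\alpha\beta}$ then $\tau, (\alpha \stackrel{t:A}{\rightarrow} \beta) \vdash \beta \ni t : A$; (message$_2$) if $\tau \vdash \alpha \ni t : A$, $A \in M_{\alpha\beta}$ and $\tau \vdash \gamma \ni s : C$ then $\tau, (\alpha \stackrel{t:A}{\rightarrow} \beta) \vdash \gamma \ni s : C$; (func) if $\tau \vdash \alpha \ni f : A \rightarrow B$ and $\tau \vdash \alpha \ni t : A$ then $\tau \vdash \alpha \ni ft : B$. A trace $\tau$ is valid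 iff $\tau \vdash \alpha \ni t : A$ is derivable for some $\alpha, t, A$. -}

module Defs where

open import Data.List using (List; []; _∷_; _++_; [_])
open import Data.List.Relation.Unary.All using (All; []; _∷_)
open import Data.Product using (Σ; _×_; _,_)
open import Relation.Binary.PropositionalEquality using (_≡_)
open import Relation.Nullary using (¬_)

infixr 20 _⇒_
data Ty (Atom : Set) : Set where
  atom : Atom → Ty Atom
  _⇒_  : Ty Atom → Ty Atom → Ty Atom

record TypeSystem : Set₁ where
  field
    Atom  : Set
    Con   : Set
    conTy : Con → Ty Atom

module _ (T : TypeSystem) where
  open TypeSystem T

  data Tm : Ty Atom → Set where
    con : (c : Con) → Tm (conTy c)
    app : ∀ {A B} → Tm (A ⇒ B) → Tm A → Tm B

  arrows : List (Ty Atom) → Ty Atom → Ty Atom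
  arrows []       B = B
  arrows (A ∷ As) B = A ⇒ arrows As B

  apps : ∀ {As B} → Tm (arrows As B) → All Tm As → Tm B
  apps f []       = f
  apps f (t ∷ ts) = apps (app f t) ts

-- An architecture over T.  M α β a : atomic type a ∈ M_{αβ}.
-- M_{αβ} is only given for distinct agents; we require it empty for α = β.
record Architecture (T : TypeSystem) : Set₁ where
  open TypeSystem T
  field
    Ag      : Set
    H       : Ag → Con → Set
    M       : Ag → Ag → Atom → Set
    M-irrefl : ∀ α a → ¬ M α α a

module Judgements (T : TypeSystem) (𝒜 : Architecture T) where
  open TypeSystem T
  open Architecture 𝒜

  _∈M_,_ : Ty Atom → Ag → Ag → Set
  A ∈M α , β = Σ Atom λ a → (A ≡ atom a) × M α β a

  record Event : Set where
    constructor ev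
    field
      src : Ag
      tgt : Ag
      ty  : Ty Atom
      tm  : Tm T ty

  -- traces: finite sequences of events (snoc lists; τ ▸ e is τ, e)
  infixl 5 _▸_
  data Trace : Set where
    ε   : Trace
    _▸_ : Trace → Event → Trace

  infixl 4 _++ᵗ_
  _++ᵗ_ : Trace → Trace → Trace
  τ ++ᵗ ε       = τ
  τ ++ᵗ (σ ▸ e) = (τ ++ᵗ σ) ▸ e

  events : Trace → List Event
  events ε       = []
  events (τ ▸ e) = events τ ++ [ e ]

  data Der : Trace → Ag → (A : Ty Atom) → Tm T A → Set

  syntax Der τ α A t = τ ⊢ α ∋ t ∶ A

  data Der where
    init  : ∀ {α c} → H α c → ε ⊢ α ∋ con c ∶ conTy c
    msg₁  : ∀ {τ α β A t} → τ ⊢ α ∋ t ∶ A → A ∈M α , β →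
            (τ ▸ ev α β A t) ⊢ β ∋ t ∶ A
    msg₂  : ∀ {τ α β γ A C t s} → τ ⊢ α ∋ t ∶ A → A ∈M α , β → τ ⊢ γ ∋ s ∶ C →
            (τ ▸ ev α β A t) ⊢ γ ∋ s ∶ C
    func  : ∀ {τ α A B f t} → τ ⊢ α ∋ f ∶ (A ⇒ B) → τ ⊢ α ∋ t ∶ A →
            τ ⊢ α ∋ app f t ∶ B

  Valid : Trace → Set
  Valid τ = Σ Ag λ α → Σ (Ty Atom) λ A → Σ (Tm T A) λ t → τ ⊢ α ∋ t ∶ A

  CanCompute : Ag → Ty Atom → Set
  CanCompute α A = Σ Con λ c → H α c × Σ (List (Ty Atom)) λ Bs → conTy c ≡ arrows T Bs A

  lastAg : Ag → List Ag → Ag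
  lastAg α []       = α
  lastAg α (β ∷ βs) = lastAg β βs

  chain : (B : Ty Atom) → Tm T B → Ag → List Ag → List Event
  chain B t α []       = []
  chain B t α (β ∷ βs) = ev α β B t ∷ chain B t β βs

-- A derivation over τ, e always contains a derivation, over τ, of the term that e sends, and the
-- fact that e is permitted by M.  Peeling events off therefore shows that validity is closed
-- under prefixes, which gives (2) and weakening.  Generation follows the derivation: init
-- supplies the constructor and the agent holding it, func appends an argument, and message rules
-- extend the forwarding chain.  Since message types are atomic, a function-typed term is never
-- sent, so the chain is empty whenever func applies.  (4) is the case split of generation on
-- whether the chain is empty.
module Submission where

open import Defs
open import Data.Empty using (⊥-elim)
open import Data.List using (List; []; _∷_; _∷ʳ_)
open import Data.List.Membership.Propositional using (_∈_)
open import Data.List.Membership.Propositional.Properties using (∈-++⁻)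
open import Data.List.Relation.Binary.Sublist.Propositional using (_⊆_; ⊆-refl; ⊆-reflexive; ⊆-trans)
open import Data.List.Relation.Binary.Sublist.Propositional.Properties
  using (++⁺; ++⁺ʳ; []⊆-universal; Any-resp-⊆)
open import Data.List.Relation.Unary.All using (All; []; _∷_; lookup)
open import Data.List.Relation.Unary.All.Properties using (∷ʳ⁺)
open import Data.List.Relation.Unary.Any using (here; there)
open import Data.Product using (Σ; _×_; _,_; proj₁; proj₂)
open import Data.Sum using (_⊎_; inj₁; inj₂)
open import Relation.Binary.PropositionalEquality using (_≡_; refl; sym; trans; cong; subst)
open import Relation.Nullary using (¬_)

lookup-∷ʳ⁺ : ∀ {X : Set} {P : X → Set} (Q : ∀ {x} → P x → Set) {xs x}
  (pxs : All P xs) {px : P x} →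
  (∀ {y} (i : y ∈ xs) → Q (lookup pxs i)) → Q px →
  ∀ {y} (i : y ∈ xs ∷ʳ x) → Q (lookup (∷ʳ⁺ pxs px) i)
lookup-∷ʳ⁺ Q []        Qpxs Qpx (here refl) = Qpx
lookup-∷ʳ⁺ Q (_ ∷ _)   Qpxs Qpx (here refl) = Qpxs (here refl)
lookup-∷ʳ⁺ Q (_ ∷ pxs) Qpxs Qpx (there i)   = lookup-∷ʳ⁺ Q pxs (λ j → Qpxs (there j)) Qpx i

module TermProperties (T : TypeSystem) where
  open TypeSystem T

  arrows-∷ʳ : ∀ As A B → arrows T As (A ⇒ B) ≡ arrows T (As ∷ʳ A) B
  arrows-∷ʳ []       A B = refl
  arrows-∷ʳ (X ∷ Xs) A B = cong (X ⇒_) (arrows-∷ʳ Xs A B)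

  subst-app : ∀ {X P Q} (P≡Q : P ≡ Q) (g : Tm T (X ⇒ P)) (u : Tm T X) →
    subst (Tm T) P≡Q (app g u) ≡ app (subst (Tm T) (cong (X ⇒_) P≡Q) g) u
  subst-app refl g u = refl

  -- Generalised over the cast eq so that it can be matched with refl; this avoids reasoning
  -- about composites of substs.
  apps-∷ʳ : ∀ As {A B C} (eq : C ≡ arrows T As (A ⇒ B)) (g : Tm T C)
    (ts : All (Tm T) As) (t : Tm T A) →
    app (apps T (subst (Tm T) eq g) ts) t
      ≡ apps T (subst (Tm T) (trans eq (arrows-∷ʳ As A B)) g) (∷ʳ⁺ ts t)
  apps-∷ʳ []       refl g []       t = refl
  apps-∷ʳ (X ∷ Xs) refl g (u ∷ us) t =
    trans (apps-∷ʳ Xs refl (app g u) us t)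
          (cong (λ h → apps T h (∷ʳ⁺ us t)) (subst-app (arrows-∷ʳ Xs _ _) g u))

module DerivationProperties (T : TypeSystem) (𝒜 : Architecture T) where
  open TypeSystem T
  open Architecture 𝒜
  open Judgements T 𝒜
  open TermProperties T

  ¬⇒∈M : ∀ {A B α β} → ¬ (A ⇒ B) ∈M α , β
  ¬⇒∈M (_ , () , _)

  valid : ∀ {τ α A t} → τ ⊢ α ∋ t ∶ A → Valid τ
  valid d = _ , _ , _ , d

  Sendable : Trace → Event → Set
  Sendable τ (ev α β A t) = (A ∈M α , β) × (τ ⊢ α ∋ t ∶ A)

  Der-▸⁻ : ∀ {τ e γ C s} → (τ ▸ e) ⊢ γ ∋ s ∶ C → Sendable τ e
  Der-▸⁻ (msg₁ d m)   = m , d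
  Der-▸⁻ (msg₂ d m _) = m , d
  Der-▸⁻ (func d _)   = Der-▸⁻ d

  Valid-▸⇒Sendable : ∀ {τ e} → Valid (τ ▸ e) → Sendable τ e
  Valid-▸⇒Sendable (_ , _ , _ , d) = Der-▸⁻ d

  Valid-▸⁻ : ∀ {τ e} → Valid (τ ▸ e) → Valid τ
  Valid-▸⁻ {e = ev _ _ _ _} v = valid (proj₂ (Valid-▸⇒Sendable v))

  Valid-++ᵗ⁻ : ∀ {τ₁} τ₂ → Valid (τ₁ ++ᵗ τ₂) → Valid τ₁
  Valid-++ᵗ⁻ ε       v = v
  Valid-++ᵗ⁻ (σ ▸ _) v = Valid-++ᵗ⁻ σ (Valid-▸⁻ v)

  Valid-++ᵗ⇒Sendable : ∀ {τ₁} τ₂ {e} → Valid ((τ₁ ▸ e) ++ᵗ τ₂) → Sendable τ₁ e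
  Valid-++ᵗ⇒Sendable τ₂ v = Valid-▸⇒Sendable (Valid-++ᵗ⁻ τ₂ v)

  weaken-▸ : ∀ {τ e γ C s} → τ ⊢ γ ∋ s ∶ C → Valid (τ ▸ e) → (τ ▸ e) ⊢ γ ∋ s ∶ C
  weaken-▸ {e = ev _ _ _ _} d v with Valid-▸⇒Sendable v
  ... | m , dₑ = msg₂ dₑ m d

  weaken : ∀ {τ₁} τ₂ {α A t} → τ₁ ⊢ α ∋ t ∶ A → Valid (τ₁ ++ᵗ τ₂) → (τ₁ ++ᵗ τ₂) ⊢ α ∋ t ∶ A
  weaken ε       d v = d
  weaken (σ ▸ _) d v = weaken-▸ (weaken σ d (Valid-▸⁻ v)) v

  Valid⇒events-permitted : ∀ {τ e} → Valid τ → e ∈ events τ →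
    Event.ty e ∈M Event.src e , Event.tgt e
  Valid⇒events-permitted {τ ▸ ev _ _ _ _} v i with ∈-++⁻ (events τ) i
  ... | inj₁ j           = Valid⇒events-permitted (Valid-▸⁻ v) j
  ... | inj₂ (here refl) = proj₁ (Valid-▸⇒Sendable v)

  chain-∷ʳ : ∀ B t α αs β →
    chain B t α (αs ∷ʳ β) ≡ chain B t α αs ∷ʳ ev (lastAg α αs) β B t
  chain-∷ʳ B t α []       β = refl
  chain-∷ʳ B t α (γ ∷ γs) β = cong (ev α γ B t ∷_) (chain-∷ʳ B t γ γs β)

  lastAg-∷ʳ : ∀ α αs β → lastAg α (αs ∷ʳ β) ≡ β
  lastAg-∷ʳ α []       β = refl
  lastAg-∷ʳ α (γ ∷ γs) β = lastAg-∷ʳ γ γs β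

  chain-last∈ : ∀ B t α γ γs → Σ Ag λ δ → ev δ (lastAg γ γs) B t ∈ chain B t α (γ ∷ γs)
  chain-last∈ B t α γ []       = α , here refl
  chain-last∈ B t α γ (δ ∷ δs) with chain-last∈ B t γ δ δs
  ... | δ′ , i = δ′ , there i

  record Generation (τ : Trace) (β : Ag) (B : Ty Atom) (t : Tm T B) : Set where
    field
      As         : List (Ty Atom)
      f          : Con
      f-ty       : conTy f ≡ arrows T As B
      args       : All (Tm T) As
      origin     : Ag
      relays     : List Ag
      t≡         : t ≡ apps T (subst (Tm T) f-ty (con f)) args
      β≡         : β ≡ lastAg origin relays
      f∈H        : H origin f
      chain⊆     : chain B t origin relays ⊆ events τ
      args-known : ∀ {A} (i : A ∈ As) → τ ⊢ origin ∋ lookup args i ∶ A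

  open Generation

  Generation-weaken : ∀ {τ e β B t} → Generation τ β B t → Sendable τ e → Generation (τ ▸ e) β B t
  Generation-weaken {e = ev _ _ _ _} g (m , dₑ) = record
    { As         = As g
    ; f          = f g
    ; f-ty       = f-ty g
    ; args       = args g
    ; origin     = origin g
    ; relays     = relays g
    ; t≡         = t≡ g
    ; β≡         = β≡ g
    ; f∈H        = f∈H g
    ; chain⊆     = ++⁺ʳ _ (chain⊆ g)
    ; args-known = λ i → msg₂ dₑ m (args-known g i)
    }

  Generation-forward : ∀ {τ α β B t} → Generation τ α B t → B ∈M α , β → τ ⊢ α ∋ t ∶ B →
    Generation (τ ▸ ev α β B t) β B t
  Generation-forward {β = β} {B} {t} g@record { β≡ = refl } m d = record
    { As         = As g
    ; f          = f g
    ; f-ty       = f-ty g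
    ; args       = args g
    ; origin     = origin g
    ; relays     = relays g ∷ʳ β
    ; t≡         = t≡ g
    ; β≡         = sym (lastAg-∷ʳ (origin g) (relays g) β)
    ; f∈H        = f∈H g
    ; chain⊆     = ⊆-trans (⊆-reflexive (chain-∷ʳ B t (origin g) (relays g) β))
                           (++⁺ (chain⊆ g) ⊆-refl)
    ; args-known = λ i → msg₂ d m (args-known g i)
    }

  Generation-apply : ∀ {τ α A B s t} → Generation τ α (A ⇒ B) s → τ ⊢ α ∋ s ∶ (A ⇒ B) →
    τ ⊢ α ∋ t ∶ A → Generation τ α B (app s t)
  Generation-apply {τ} {A = A} {B} {t = t} g@record { relays = [] ; β≡ = refl } d dₜ = record
    { As         = As g ∷ʳ A
    ; f          = f g
    ; f-ty       = trans (f-ty g) (arrows-∷ʳ (As g) A B)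
    ; args       = ∷ʳ⁺ (args g) t
    ; origin     = origin g
    ; relays     = []
    ; t≡         = trans (cong (λ h → app h t) (t≡ g))
                         (apps-∷ʳ (As g) (f-ty g) (con (f g)) (args g) t)
    ; β≡         = refl
    ; f∈H        = f∈H g
    ; chain⊆     = []⊆-universal _
    ; args-known = lookup-∷ʳ⁺ (λ {A} u → τ ⊢ origin g ∋ u ∶ A) (args g) (args-known g) dₜ
    }
  Generation-apply g@record { relays = _ ∷ _ } d dₜ =
    ⊥-elim (¬⇒∈M (Valid⇒events-permitted (valid d) (Any-resp-⊆ (chain⊆ g) (here refl))))

  generation : ∀ {τ β B t} → τ ⊢ β ∋ t ∶ B → Generation τ β B t
  generation (init {α = α} {c = c} h) = record
    { As = [] ; f = c ; f-ty = refl ; args = [] ; origin = α ; relays = []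
    ; t≡ = refl ; β≡ = refl ; f∈H = h ; chain⊆ = ⊆-refl ; args-known = λ () }
  generation (msg₁ d m)    = Generation-forward (generation d) m d
  generation (msg₂ d m d′) = Generation-weaken (generation d′) (m , d)
  generation (func d dₜ)   = Generation-apply (generation d) d dₜ

  computes-or-receives : ∀ {τ β B t} → τ ⊢ β ∋ t ∶ B →
    CanCompute β B ⊎ Σ Ag λ α → ev α β B t ∈ events τ
  computes-or-receives d with generation d
  ... | g@record { relays = [] ; β≡ = refl } = inj₁ (f g , f∈H g , As g , f-ty g)
  ... | g@record { relays = γ ∷ γs ; β≡ = refl } with chain-last∈ _ _ (origin g) γ γs
  ...   | α , i = inj₂ (α , Any-resp-⊆ (chain⊆ g) i)

lemma1 : (T : TypeSystem) (𝒜 : Architecture T) →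
  let open TypeSystem T
      open Architecture 𝒜
      open Judgements T 𝒜
  in
  -- (1) weakening
  (∀ {τ₁ τ₂ α A t} → τ₁ ⊢ α ∋ t ∶ A → Valid (τ₁ ++ᵗ τ₂) → (τ₁ ++ᵗ τ₂) ⊢ α ∋ t ∶ A)
  -- (2)
  × (∀ {τ₁ τ₂ α β A t} → Valid ((τ₁ ▸ ev α β A t) ++ᵗ τ₂) →
       (A ∈M α , β) × (τ₁ ⊢ α ∋ t ∶ A))
  -- (3) generation
  × (∀ {τ β B t} → τ ⊢ β ∋ t ∶ B →
       Σ (List (Ty Atom)) λ As →
       Σ Con λ f →
       Σ (conTy f ≡ arrows T As B) λ eq →
       Σ (All (Tm T) As) λ ts →
       Σ Ag λ α₁ → Σ (List Ag) λ αs →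
         (t ≡ apps T (subst (Tm T) eq (con f)) ts)
         × (β ≡ lastAg α₁ αs)
         × H α₁ f
         × (chain B t α₁ αs ⊆ events τ)
         × (∀ {A} (i : A ∈ As) → τ ⊢ α₁ ∋ Data.List.Relation.Unary.All.lookup ts i ∶ A))
  -- (4)
  × (∀ {τ β B t} → τ ⊢ β ∋ t ∶ B →
       CanCompute β B ⊎ Σ Ag λ α → ev α β B t ∈ events τ)
lemma1 T 𝒜 =
  (λ {_} {τ₂} → weaken τ₂) ,
  (λ {_} {τ₂} → Valid-++ᵗ⇒Sendable τ₂) ,
  (λ d → let g = generation d in
    As g , f g , f-ty g , args g , origin g , relays g ,
    t≡ g , β≡ g , f∈H g , chain⊆ g , args-known g) ,
  computes-or-receives
  where open DerivationProperties T 𝒜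
        open Generation
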